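{- Let $r,s$ be real numbers with $r^2+4s\ge 0$, and let $(h_n)_{n\ge0}$ be defined by $h_0=0$, $h_1=1$, $h_{n}=rh_{n-1}+sh_{n-2}$ for $n\ge 2$. Then for every integer $n\geq 2$, $$h_{n}^{3}+h_{n-1}^{2}h_{n+2}+h_{n+1}^{2}h_{n-2}=h_{n}\left(h_{n-2}h_{n+2}+2h_{n-1}h_{n+1}\right).$$
   Context: The generalized Fibonacci numbers $h_n$ depend on the real parameters $r,s$ via $h_0=0$, $h_1=1$, $h_n=rh_{n-1}+sh_{n-2}$. -}

module Defs where

open import Level using (Level)
open import Data.Nat using (ℕ; zero; suc)
open import Algebra.Bundles using (CommutativeRing)

module _ {c ℓ : Level} (R : CommutativeRing c ℓ) where
  open CommutativeRing R

  genFib : Carrier → Carrier → ℕ → Carrier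
  genFib r s zero = 0#
  genFib r s (suc zero) = 1#
  genFib r s (suc (suc n)) = r * genFib r s (suc n) + s * genFib r s n

  four : Carrier
  four = 1# + 1# + 1# + 1#

-- Expressing h (n+1) and h (n+2) through the recurrence, both sides become
-- polynomials in r, s, h (n-2), h (n-1), and they agree as polynomials. The
-- identity therefore holds for every solution of the recurrence over any
-- commutative ring.
module Submission where

open import Defs
open import Level using (Level)
open import Data.Nat using (ℕ; _∸_; _≤_; s≤s; z≤n) renaming (suc to sucℕ)
open import Algebra.Bundles using (CommutativeRing)
open import Relation.Binary.Core using (Rel)

module _ {c ℓ : Level} (R : CommutativeRing c ℓ) where
  open CommutativeRing R
  open import Algebra.Solver.Ring.NaturalCoefficients.Default commutativeSemiring

  recurrence-cubicIdentity : ∀ r s x₀ x₁ →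
    let x₂ = r * x₁ + s * x₀
        x₃ = r * x₂ + s * x₁
        x₄ = r * x₃ + s * x₂
    in x₂ * x₂ * x₂ + x₁ * x₁ * x₄ + x₃ * x₃ * x₀
       ≈ x₂ * (x₀ * x₄ + (1# + 1#) * x₁ * x₃)
  recurrence-cubicIdentity = solve 4 (λ r s x₀ x₁ →
    let x₂ = r :* x₁ :+ s :* x₀
        x₃ = r :* x₂ :+ s :* x₁
        x₄ = r :* x₃ :+ s :* x₂
    in x₂ :* x₂ :* x₂ :+ x₁ :* x₁ :* x₄ :+ x₃ :* x₃ :* x₀
       := x₂ :* (x₀ :* x₄ :+ (con 1 :+ con 1) :* x₁ :* x₃)) refl

mainTheorem5 : {c ℓ ℓ′ : Level} (R : CommutativeRing c ℓ) →
  let open CommutativeRing R in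
  -- an (arbitrary) order relation on the carrier, used for the hypothesis r^2+4s ≥ 0
  (_≤R_ : Rel Carrier ℓ′) →
  (r s : Carrier) → 0# ≤R (r * r + four R * s) →
  (n : ℕ) → 2 ≤ n →
  let h = genFib R r s in
  h n * h n * h n + h (n ∸ 1) * h (n ∸ 1) * h (sucℕ (sucℕ n)) + h (sucℕ n) * h (sucℕ n) * h (n ∸ 2)
    ≈ h n * (h (n ∸ 2) * h (sucℕ (sucℕ n)) + (1# + 1#) * h (n ∸ 1) * h (sucℕ n))
mainTheorem5 R _ r s _ (sucℕ (sucℕ m)) (s≤s (s≤s z≤n)) =
  recurrence-cubicIdentity R r s (genFib R r s m) (genFib R r s (sucℕ m))
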